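{- Every regular bipartite graph is isomorphic to the graph of stably matchable pairs of some stable matching instance.
   Context: A stable matching instance consists of finite disjoint sets of students and residencies, where each student has a strict linear preference order on a subset of the residencies and each residency has a strict linear preference order on a subset of the students. A matching (set of student–residency pairs, each element in at most one pair) is stable if each of its pairs is mutually acceptable (each member appears in the other's list) and no mutually acceptable pair $(s,r)$ not in it has both $s$ unmatched or preferring $r$ to its partner and $r$ unmatched or preferring $s$ to its partner. The graph of stably matchable pairs of the instance is the bipartite graph whose vertices are all students and residencies and whose edges are the pairs occurring in at least one stable matching. -}

module Defs where

open import Data.Nat using (ℕ)
open import Data.Bool using (Bool; true; false)
open import Data.Fin using (Fin; _<_)
open import Data.Fin.Base using ()
open import Data.List using (List; length; lookup; filterᵇ; allFin)
open import Data.List.Membership.Propositional using (_∈_)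
open import Data.List.Relation.Unary.Unique.Propositional using (Unique)
open import Data.Product using (Σ; ∃; _×_; _,_)
open import Data.Sum using (_⊎_; inj₁; inj₂)
open import Data.Empty using (⊥)
open import Relation.Nullary using (¬_)
open import Relation.Binary.PropositionalEquality using (_≡_; _≢_)
open import Function.Bundles using (_↔_; Inverse; _⇔_)

record Graph : Set where
  field
    n     : ℕ
    adj   : Fin n → Fin n → Bool
    sym   : ∀ u v → adj u v ≡ true → adj v u ≡ true
    irrefl : ∀ u → adj u u ≡ false

open Graph public

degree : (G : Graph) → Fin (n G) → ℕ
degree G u = length (filterᵇ (adj G u) (allFin (n G)))

IsRegular : Graph → Set
IsRegular G = Σ ℕ λ k → ∀ u → degree G u ≡ k

IsBipartite : Graph → Set
IsBipartite G = Σ (Fin (n G) → Bool) λ c → ∀ u v → adj G u v ≡ true → c u ≢ c v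

-- A strict linear order on a subset of a finite set is represented by a
-- duplicate-free list: earlier in the list = more preferred; the subset
-- is the set of list members (the acceptable partners).

record Instance : Set where
  field
    nS nR  : ℕ
    sPref  : Fin nS → List (Fin nR)
    rPref  : Fin nR → List (Fin nS)
    sPrefUnique : ∀ s → Unique (sPref s)
    rPrefUnique : ∀ r → Unique (rPref r)

open Instance public

Prefers : ∀ {m} → List (Fin m) → Fin m → Fin m → Set
Prefers L x y = Σ (Fin (length L)) λ i → Σ (Fin (length L)) λ j →
  lookup L i ≡ x × lookup L j ≡ y × i < j

module _ (I : Instance) where

  MutuallyAcceptable : Fin (nS I) → Fin (nR I) → Set
  MutuallyAcceptable s r = r ∈ sPref I s × s ∈ rPref I r

  record Matching : Set where
    field
      M      : Fin (nS I) → Fin (nR I) → Bool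
      sUniq  : ∀ s r r′ → M s r ≡ true → M s r′ ≡ true → r ≡ r′
      rUniq  : ∀ s s′ r → M s r ≡ true → M s′ r ≡ true → s ≡ s′

  open Matching public

  module _ (μ : Matching) where

    StudentWantsToSwitch : Fin (nS I) → Fin (nR I) → Set
    StudentWantsToSwitch s r =
      (∀ r′ → M μ s r′ ≢ true) ⊎
      (Σ (Fin (nR I)) λ r′ → M μ s r′ ≡ true × Prefers (sPref I s) r r′)

    ResidencyWantsToSwitch : Fin (nS I) → Fin (nR I) → Set
    ResidencyWantsToSwitch s r =
      (∀ s′ → M μ s′ r ≢ true) ⊎
      (Σ (Fin (nS I)) λ s′ → M μ s′ r ≡ true × Prefers (rPref I r) s s′)

    BlockingPair : Fin (nS I) → Fin (nR I) → Set
    BlockingPair s r =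
      MutuallyAcceptable s r × M μ s r ≢ true ×
      StudentWantsToSwitch s r × ResidencyWantsToSwitch s r

    Stable : Set
    Stable = (∀ s r → M μ s r ≡ true → MutuallyAcceptable s r) ×
             (∀ s r → ¬ BlockingPair s r)

  StablyMatchable : Fin (nS I) → Fin (nR I) → Set
  StablyMatchable s r = Σ Matching λ μ → Stable μ × M μ s r ≡ true

  SMVertex : Set
  SMVertex = Fin (nS I) ⊎ Fin (nR I)

  SMAdj : SMVertex → SMVertex → Set
  SMAdj (inj₁ s) (inj₂ r) = StablyMatchable s r
  SMAdj (inj₂ r) (inj₁ s) = StablyMatchable s r
  SMAdj (inj₁ _) (inj₁ _) = ⊥
  SMAdj (inj₂ _) (inj₂ _) = ⊥

IsoToSMGraph : Graph → Instance → Set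
IsoToSMGraph G I =
  Σ (Fin (n G) ↔ SMVertex I) λ φ →
    ∀ u v → (adj G u v ≡ true) ⇔ SMAdj I (Inverse.to φ u) (Inverse.to φ v)

-- A k-regular bipartite graph is the union of k pairwise disjoint perfect matchings σ₀, …, σₖ₋₁:
-- double counting edges gives Hall's condition, Hall's theorem gives one perfect matching, and
-- removing it leaves a (k-1)-regular graph. Take the two colour classes as students and residencies,
-- let each student s rank σ₀(s), σ₁(s), … in this order and each residency rank its partners in the
-- reverse order. Every σₜ is then stable, because a blocking pair (s , σᵤ(s)) would need u < t for
-- the student and t < u for the residency. Conversely a stably matchable pair is mutually
-- acceptable, i.e. an edge.

module Submission where

open import Defs hiding (sym)
open import Data.Bool using (Bool; true; false; T; not; _∧_; _∨_; if_then_else_)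
open import Data.Bool.Properties using (T-≡; T-∧; T-∨; ∧-identityʳ)
open import Data.Empty using (⊥-elim)
open import Data.Fin using (Fin; zero; suc; _≟_; toℕ; cast; opposite; punchOut) renaming (_<_ to _<ᶠ_)
open import Data.Fin.Properties
  using (any?; all?; injective⇒≤; punchOut-injective; toℕ-cast; opposite-prop; opposite-involutive; <-asym)
open import Data.Fin.Subset.Properties using (anySubset?)
open import Data.List using (length; lookup; tabulate; filterᵇ)
open import Data.List.Membership.Propositional using (_∈_)
open import Data.List.Membership.Propositional.Properties using (∈-tabulate⁺; ∈-tabulate⁻)
open import Data.List.Properties using (length-tabulate)
open import Data.List.Relation.Unary.Unique.Propositional.Properties using (tabulate⁺)
open import Data.Nat using (ℕ; zero; suc; _+_; _*_; _∸_; _≤_; _<_; z≤n; s≤s; _≤?_; _<?_)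
open import Data.Nat.Induction using (<-wellFounded)
open import Data.Nat.Properties
  using ( ≤-refl; ≤-trans; ≤-reflexive; <-≤-trans; ≤-<-trans; ≮⇒≥; ≰⇒>; <⇒≱; n≤0⇒n≡0; n≮0; m<1+n⇒m≤n
        ; n<1+n; suc-injective; +-assoc; +-comm; +-identityʳ; *-identityˡ; +-mono-≤; +-monoʳ-≤; +-monoˡ-<
        ; +-cancelʳ-≤; *-cancelʳ-≤; ∸-monoʳ-≤; +-*-semiring; +-commutativeSemigroup; module ≤-Reasoning)
open import Algebra.Properties.CommutativeSemigroup +-commutativeSemigroup using (x∙yz≈y∙xz)
open import Algebra.Properties.Semiring.Sum +-*-semiring
  using (sum; sum-syntax; sum-cong-≗; ∑-distrib-+; ∑-comm; *-distribʳ-sum; sum-replicate-zero)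
open import Data.Product using (Σ; ∃; _×_; _,_; proj₁; proj₂; swap)
open import Data.Sum using (_⊎_; inj₁; inj₂; [_,_]; map₁; map₂)
open import Data.Unit using (tt)
import Data.Vec as Vec
open import Data.Vec.Properties using (lookup∘tabulate)
open import Function using (_∘_; _⇔_; id; const; flip; Injective)
open import Function.Bundles using (Equivalence; mk⇔; _↔_; Inverse; mk↔ₛ′)
open import Function.Construct.Composition using (_⇔-∘_)
open import Function.Construct.Symmetry using (⇔-sym)
open import Induction.WellFounded using (Acc; acc)
open import Relation.Nullary using (¬_; Dec; yes; no; does; ⌊_⌋; contradiction)
open import Relation.Nullary.Decidable using (T?; toWitness; fromWitness; map′; _×-dec_; _→-dec_)
open import Relation.Binary.PropositionalEquality
  using (_≡_; _≢_; refl; sym; trans; cong; subst; subst₂; _≗_; module ≡-Reasoning)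

private
  variable
    m m′ k : ℕ

-- Subsets of Fin m as Boolean predicates

infix 4 _⊆_ _⊆?_
infixr 6 _∪_
infixl 5 _─_ _-_

_⊆_ : (Fin m → Bool) → (Fin m → Bool) → Set
p ⊆ q = ∀ {i} → T (p i) → T (q i)

_∪_ _─_ : (Fin m → Bool) → (Fin m → Bool) → Fin m → Bool
(p ∪ q) i = p i ∨ q i
(p ─ q) i = p i ∧ not (q i)

⁅_⁆ : Fin m → Fin m → Bool
⁅ a ⁆ i = does (i ≟ a)

_-_ : (Fin m → Bool) → Fin m → Fin m → Bool
p - a = p ─ ⁅ a ⁆

T-─ : ∀ {a b} → T (a ∧ not b) ⇔ (T a × ¬ T b)
T-─ {true}  {true}  = mk⇔ (λ ()) (λ (_ , ¬b) → ¬b tt)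
T-─ {true}  {false} = mk⇔ (const (tt , id)) (const tt)
T-─ {false} {b}     = mk⇔ (λ ()) proj₁

T-⁅⁆ : ∀ {a i : Fin m} → T (⁅ a ⁆ i) ⇔ i ≡ a
T-⁅⁆ {a = a} {i} with i ≟ a
... | yes i≡a = mk⇔ (const i≡a) (const tt)
... | no  i≢a = mk⇔ (λ ()) i≢a

⁅⁆⊆ : ∀ {p : Fin m → Bool} {a} → T (p a) → ⁅ a ⁆ ⊆ p
⁅⁆⊆ {a = a} a∈p {i} i∈⁅a⁆ with refl ← Equivalence.to (T-⁅⁆ {a = a} {i}) i∈⁅a⁆ = a∈p

_⊆?_ : (p q : Fin m → Bool) → Dec (p ⊆ q)
p ⊆? q = map′ (λ p⊆q {i} → p⊆q i) (λ p⊆q i → p⊆q) (all? λ i → T? (p i) →-dec T? (q i))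

𝟙 : Bool → ℕ
𝟙 b = if b then 1 else 0

count : (Fin m → Bool) → ℕ
count {m} p = ∑[ i < m ] 𝟙 (p i)

sum-mono-≤ : ∀ {f g : Fin m → ℕ} → (∀ i → f i ≤ g i) → sum f ≤ sum g
sum-mono-≤ {zero}  f≤g = z≤n
sum-mono-≤ {suc m} f≤g = +-mono-≤ (f≤g zero) (sum-mono-≤ (f≤g ∘ suc))

count-cong : ∀ {p q : Fin m → Bool} → p ≗ q → count p ≡ count q
count-cong p≗q = sum-cong-≗ (cong 𝟙 ∘ p≗q)

count-mono : ∀ {p q : Fin m → Bool} → p ⊆ q → count p ≤ count q
count-mono {p = p} {q} p⊆q = sum-mono-≤ λ i → 𝟙-mono (p i) (q i) p⊆q
  where
  𝟙-mono : ∀ a b → (T a → T b) → 𝟙 a ≤ 𝟙 b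
  𝟙-mono false _     _   = z≤n
  𝟙-mono true  true  _   = ≤-refl
  𝟙-mono true  false a⇒b = ⊥-elim (a⇒b tt)

count-∪ : (p q : Fin m → Bool) → count (p ∪ q) ≤ count p + count q
count-∪ p q = begin
  count (p ∪ q)                    ≤⟨ sum-mono-≤ (λ i → 𝟙-∨ (p i) (q i)) ⟩
  sum (λ i → 𝟙 (p i) + 𝟙 (q i))   ≡⟨ ∑-distrib-+ (𝟙 ∘ p) (𝟙 ∘ q) ⟩
  count p + count q                ∎
  where
  open ≤-Reasoning
  𝟙-∨ : ∀ a b → 𝟙 (a ∨ b) ≤ 𝟙 a + 𝟙 b
  𝟙-∨ true  _ = s≤s z≤n
  𝟙-∨ false _ = ≤-refl

count-∪-disjoint : (p q : Fin m → Bool) → (∀ {i} → T (p i) → ¬ T (q i)) →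
                   count (p ∪ q) ≡ count p + count q
count-∪-disjoint p q p∩q≡∅ =
  trans (sum-cong-≗ λ i → 𝟙-∨ (p i) (q i) p∩q≡∅) (∑-distrib-+ (𝟙 ∘ p) (𝟙 ∘ q))
  where
  𝟙-∨ : ∀ a b → (T a → ¬ T b) → 𝟙 (a ∨ b) ≡ 𝟙 a + 𝟙 b
  𝟙-∨ true  true  a⇒¬b = ⊥-elim (a⇒¬b tt tt)
  𝟙-∨ true  false _    = refl
  𝟙-∨ false _     _    = refl

count-⊆-split : ∀ {p q : Fin m → Bool} → p ⊆ q → count q ≡ count p + count (q ─ p)
count-⊆-split {p = p} {q} p⊆q = begin
  count q                  ≡⟨ count-cong (λ i → split (p i) (q i) p⊆q) ⟩
  count (p ∪ (q ─ p))      ≡⟨ count-∪-disjoint p (q ─ p) p∩[q─p]≡∅ ⟩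
  count p + count (q ─ p)  ∎
  where
  open ≡-Reasoning
  split : ∀ a b → (T a → T b) → b ≡ a ∨ (b ∧ not a)
  split true  true  _   = refl
  split true  false a⇒b = ⊥-elim (a⇒b tt)
  split false b     _   = sym (∧-identityʳ b)
  p∩[q─p]≡∅ : ∀ {i} → T (p i) → ¬ T ((q ─ p) i)
  p∩[q─p]≡∅ i∈p i∈q─p = proj₂ (Equivalence.to T-─ i∈q─p) i∈p

count-⁅⁆ : (a : Fin m) → count ⁅ a ⁆ ≡ 1
count-⁅⁆ {suc m} zero    = cong suc (sum-replicate-zero m)
count-⁅⁆ {suc m} (suc a) = count-⁅⁆ a

count-remove : ∀ {p : Fin m → Bool} {a} → T (p a) → count p ≡ suc (count (p - a))
count-remove {p = p} {a} a∈p =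
  trans (count-⊆-split {p = ⁅ a ⁆} {p} (⁅⁆⊆ {p = p} a∈p)) (cong (_+ count (p - a)) (count-⁅⁆ a))

∈⇒0<count : ∀ {p : Fin m → Bool} {a} → T (p a) → 0 < count p
∈⇒0<count {p = p} {a} a∈p = begin
  1            ≡⟨ count-⁅⁆ a ⟨
  count ⁅ a ⁆  ≤⟨ count-mono {p = ⁅ a ⁆} {p} (⁅⁆⊆ {p = p} a∈p) ⟩
  count p      ∎
  where open ≤-Reasoning

0<count⇒∈ : (p : Fin m → Bool) → 0 < count p → ∃ λ i → T (p i)
0<count⇒∈ {suc m} p 0<count with p zero in p₀
... | true  = zero , Equivalence.from T-≡ p₀
... | false = let i , i∈p = 0<count⇒∈ (p ∘ suc) 0<count in suc i , i∈p

∉⇒count≡0 : ∀ {p : Fin m → Bool} → (∀ i → ¬ T (p i)) → count p ≡ 0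
∉⇒count≡0 {p = p} p≡∅ = n≤0⇒n≡0 (≮⇒≥ λ 0<count → let i , i∈p = 0<count⇒∈ p 0<count in p≡∅ i i∈p)

-- Hall's theorem

-- Opaque, so that unification sees `Neighbours E S j` rather than the `any?` behind it.
opaque
  Neighbours : (Fin m → Fin m′ → Bool) → (Fin m → Bool) → Fin m′ → Bool
  Neighbours E S j = ⌊ any? (λ i → T? (S i ∧ E i j)) ⌋

  T-Neighbours : ∀ {E : Fin m → Fin m′ → Bool} {S j} →
                 T (Neighbours E S j) ⇔ ∃ λ i → T (S i) × T (E i j)
  T-Neighbours {E = E} {S} {j} = mk⇔ to from
    where
    to : T (Neighbours E S j) → ∃ λ i → T (S i) × T (E i j)
    to j∈N with i , i∈S∩Eʲ ← toWitness j∈N = i , Equivalence.to T-∧ i∈S∩Eʲ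
    from : (∃ λ i → T (S i) × T (E i j)) → T (Neighbours E S j)
    from (i , i∈S , e) = fromWitness (i , Equivalence.from T-∧ (i∈S , e))

_avoiding_ : (Fin m → Fin m′ → Bool) → (Fin m′ → Bool) → Fin m → Fin m′ → Bool
(E avoiding C) i j = E i j ∧ not (C j)

HallCondition : (Fin m → Fin m′ → Bool) → (Fin m → Bool) → Set
HallCondition E L = ∀ S → S ⊆ L → count S ≤ count (Neighbours E S)

record SaturatingMatching (E : Fin m → Fin m′ → Bool) (L : Fin m → Bool) : Set where
  field
    partner           : ∀ i → T (L i) → Fin m′
    partner-edge      : ∀ i i∈L → T (E i (partner i i∈L))
    partner-injective : ∀ {i i′} i∈L i′∈L → partner i i∈L ≡ partner i′ i′∈L → i ≡ i′

open SaturatingMatching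

module _ {E : Fin m → Fin m′ → Bool} where

  Neighbours-mono : ∀ {S S′} → S ⊆ S′ → Neighbours E S ⊆ Neighbours E S′
  Neighbours-mono S⊆S′ j∈N with i , i∈S , e ← Equivalence.to T-Neighbours j∈N =
    Equivalence.from T-Neighbours (i , S⊆S′ i∈S , e)

  Neighbours-∪ : ∀ {S S′} → Neighbours E (S ∪ S′) ⊆ Neighbours E S ∪ Neighbours E S′
  Neighbours-∪ j∈N with i , i∈S∪S′ , e ← Equivalence.to T-Neighbours j∈N =
    Equivalence.from T-∨ (Data.Sum.map (λ i∈S → Equivalence.from T-Neighbours (i , i∈S , e))
                                       (λ i∈S′ → Equivalence.from T-Neighbours (i , i∈S′ , e))
                                       (Equivalence.to T-∨ i∈S∪S′))

  Neighbours-avoiding : ∀ {S C} → Neighbours E S ⊆ Neighbours (E avoiding C) S ∪ C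
  Neighbours-avoiding {C = C} {j} j∈N with T? (C j)
  ... | yes j∈C = Equivalence.from T-∨ (inj₂ j∈C)
  ... | no  j∉C with i , i∈S , e ← Equivalence.to T-Neighbours j∈N =
    Equivalence.from T-∨ (inj₁ (Equivalence.from T-Neighbours (i , i∈S , Equivalence.from T-─ (e , j∉C))))

  Neighbours-⁅⁆ : ∀ {a j} → T (Neighbours E ⁅ a ⁆ j) → T (E a j)
  Neighbours-⁅⁆ {a} {j} j∈N with i , i∈⁅a⁆ , e ← Equivalence.to T-Neighbours j∈N =
    subst (λ i → T (E i j)) (Equivalence.to T-⁅⁆ i∈⁅a⁆) e

  hall-⊆ : ∀ {L S} → S ⊆ L → HallCondition E L → HallCondition E S
  hall-⊆ S⊆L hallL U U⊆S = hallL U (S⊆L ∘ U⊆S)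

  hall⇒edge : ∀ {L} → HallCondition E L → 0 < count L → ∃ λ a → T (L a) × ∃ λ b → T (E a b)
  hall⇒edge {L} hallL L≢∅ with a , a∈L ← 0<count⇒∈ L L≢∅
    with b , b∈N ← 0<count⇒∈ (Neighbours E ⁅ a ⁆)
                     (subst (_≤ count (Neighbours E ⁅ a ⁆)) (count-⁅⁆ a) (hallL ⁅ a ⁆ (⁅⁆⊆ {p = L} a∈L)))
    = a , a∈L , b , Neighbours-⁅⁆ b∈N

  Tight : (Fin m → Bool) → (Fin m → Bool) → Set
  Tight L S = S ⊆ L × 0 < count S × count S < count L × count (Neighbours E S) ≤ count S

  Surplus : (Fin m → Bool) → Set
  Surplus L = ∀ S → S ⊆ L → 0 < count S → count S < count L → count S < count (Neighbours E S)

  hall-avoiding-tight : ∀ {L S} → HallCondition E L → S ⊆ L → count (Neighbours E S) ≤ count S →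
                        HallCondition (E avoiding Neighbours E S) (L ─ S)
  hall-avoiding-tight {L} {S} hallL S⊆L NS≤S U U⊆L─S = +-cancelʳ-≤ (count S) (count U) _ (begin
    count U + count S             ≡⟨ count-∪-disjoint U S U∩S≡∅ ⟨
    count (U ∪ S)                 ≤⟨ hallL (U ∪ S) U∪S⊆L ⟩
    count (Neighbours E (U ∪ S))  ≤⟨ count-mono {p = Neighbours E (U ∪ S)} {NU′ ∪ NS} N[U∪S]⊆NU′∪NS ⟩
    count (NU′ ∪ NS)              ≤⟨ count-∪ NU′ NS ⟩
    count NU′ + count NS          ≤⟨ +-monoʳ-≤ (count NU′) NS≤S ⟩
    count NU′ + count S           ∎)
    where
    open ≤-Reasoning
    NS NU′ : Fin m′ → Bool
    NS = Neighbours E S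
    NU′ = Neighbours (E avoiding NS) U
    U∩S≡∅ : ∀ {i} → T (U i) → ¬ T (S i)
    U∩S≡∅ = proj₂ ∘ Equivalence.to T-─ ∘ U⊆L─S
    U∪S⊆L : U ∪ S ⊆ L
    U∪S⊆L = [ proj₁ ∘ Equivalence.to T-─ ∘ U⊆L─S , S⊆L ] ∘ Equivalence.to T-∨
    N[U∪S]⊆NU′∪NS : Neighbours E (U ∪ S) ⊆ NU′ ∪ NS
    N[U∪S]⊆NU′∪NS = [ Neighbours-avoiding {S = U} {C = NS} , Equivalence.from T-∨ ∘ inj₂ ]
                  ∘ Equivalence.to T-∨ ∘ Neighbours-∪ {S = U} {S}

  hall-avoiding-edge : ∀ {L a b} → Surplus L → T (L a) → HallCondition (E avoiding ⁅ b ⁆) (L - a)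
  hall-avoiding-edge {L} {a} {b} surplus a∈L U U⊆L-a with 0 <? count U
  ... | no  U≡∅ = ≤-trans (≮⇒≥ U≡∅) z≤n
  ... | yes U≢∅ = m<1+n⇒m≤n (begin-strict
    count U                 <⟨ surplus U (proj₁ ∘ Equivalence.to T-─ ∘ U⊆L-a) U≢∅ U<L ⟩
    count (Neighbours E U)  ≤⟨ count-mono {p = Neighbours E U} {NU′ ∪ ⁅ b ⁆} (Neighbours-avoiding {S = U}) ⟩
    count (NU′ ∪ ⁅ b ⁆)     ≤⟨ count-∪ NU′ ⁅ b ⁆ ⟩
    count NU′ + count ⁅ b ⁆ ≡⟨ cong (count NU′ +_) (count-⁅⁆ b) ⟩
    count NU′ + 1           ≡⟨ +-comm (count NU′) 1 ⟩
    suc (count NU′)         ∎)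
    where
    open ≤-Reasoning
    NU′ : Fin m′ → Bool
    NU′ = Neighbours (E avoiding ⁅ b ⁆) U
    U<L : count U < count L
    U<L = begin-strict
      count U              ≤⟨ count-mono {p = U} {L - a} U⊆L-a ⟩
      count (L - a)        <⟨ n<1+n _ ⟩
      suc (count (L - a))  ≡⟨ count-remove {p = L} a∈L ⟨
      count L              ∎

  Tight-resp : ∀ {L S S′} → S ⊆ S′ → S′ ⊆ S → Tight L S → Tight L S′
  Tight-resp {L} {S} {S′} S⊆S′ S′⊆S (S⊆L , S≢∅ , S<L , NS≤S) =
    S⊆L ∘ S′⊆S ,
    <-≤-trans S≢∅ S≤S′ ,
    ≤-<-trans S′≤S S<L ,
    ≤-trans (count-mono {p = Neighbours E S′} {Neighbours E S} (Neighbours-mono S′⊆S)) (≤-trans NS≤S S≤S′)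
    where
    S≤S′ : count S ≤ count S′
    S≤S′ = count-mono {p = S} {S′} S⊆S′
    S′≤S : count S′ ≤ count S
    S′≤S = count-mono {p = S′} {S} S′⊆S

  tight? : ∀ L S → Dec (Tight L S)
  tight? L S = S ⊆? L ×-dec 0 <? count S ×-dec count S <? count L ×-dec count (Neighbours E S) ≤? count S

  -- anySubset? searches subsets encoded as vectors; Tight-resp carries the answer back to predicates.
  tight-or-surplus : ∀ L → ∃ (Tight L) ⊎ Surplus L
  tight-or-surplus L with anySubset? (tight? L ∘ Vec.lookup)
  ... | yes (V , tight) = inj₁ (Vec.lookup V , tight)
  ... | no  ¬tight      = inj₂ λ S S⊆L S≢∅ S<L → ≰⇒> λ NS≤S →
    ¬tight (Vec.tabulate S , Tight-resp (encode S) (decode S) (S⊆L , S≢∅ , S<L , NS≤S))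
    where
    encode : ∀ S → S ⊆ Vec.lookup (Vec.tabulate S)
    encode S {i} = subst T (sym (lookup∘tabulate S i))
    decode : ∀ S → Vec.lookup (Vec.tabulate S) ⊆ S
    decode S {i} = subst T (lookup∘tabulate S i)

  empty-matching : ∀ {L} → ¬ 0 < count L → SaturatingMatching E L
  empty-matching {L} L≡∅ = record
    { partner           = λ _ → ⊥-elim ∘ ∉L
    ; partner-edge      = λ _ → ⊥-elim ∘ ∉L
    ; partner-injective = λ i∈L → ⊥-elim (∉L i∈L)
    }
    where
    ∉L : ∀ {i} → ¬ T (L i)
    ∉L = L≡∅ ∘ ∈⇒0<count {p = L}

  edge-matching : ∀ {a b} → T (E a b) → SaturatingMatching E ⁅ a ⁆
  edge-matching {a} {b} e = record
    { partner           = λ _ _ → b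
    ; partner-edge      = λ i i∈⁅a⁆ → subst (λ i → T (E i b)) (sym (≡a i∈⁅a⁆)) e
    ; partner-injective = λ i∈⁅a⁆ i′∈⁅a⁆ _ → trans (≡a i∈⁅a⁆) (sym (≡a i′∈⁅a⁆))
    }
    where
    ≡a : ∀ {i} → T (⁅ a ⁆ i) → i ≡ a
    ≡a = Equivalence.to T-⁅⁆

  join : ∀ {L S C} → S ⊆ L → (M : SaturatingMatching E S) → (∀ i i∈S → T (C (partner M i i∈S))) →
         SaturatingMatching (E avoiding C) (L ─ S) → SaturatingMatching E L
  join {L} {S} {C} S⊆L M M⊆C M′ = record
    { partner           = λ i i∈L → choose i i∈L (T? (S i))
    ; partner-edge      = λ i i∈L → edge i i∈L (T? (S i))
    ; partner-injective = λ {i} {i′} i∈L i′∈L → injective i∈L i′∈L (T? (S i)) (T? (S i′))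
    }
    where
    rest : ∀ {i} → T (L i) → ¬ T (S i) → T ((L ─ S) i)
    rest i∈L i∉S = Equivalence.from T-─ (i∈L , i∉S)

    choose : ∀ i → T (L i) → Dec (T (S i)) → Fin m′
    choose i i∈L (yes i∈S) = partner M i i∈S
    choose i i∈L (no  i∉S) = partner M′ i (rest i∈L i∉S)

    edge : ∀ i i∈L i∈S? → T (E i (choose i i∈L i∈S?))
    edge i i∈L (yes i∈S) = partner-edge M i i∈S
    edge i i∈L (no  i∉S) = proj₁ (Equivalence.to T-─ (partner-edge M′ i (rest i∈L i∉S)))

    M≢M′ : ∀ {i i′} i∈S i′∈L─S → partner M i i∈S ≢ partner M′ i′ i′∈L─S
    M≢M′ {i} {i′} i∈S i′∈L─S eq =
      proj₂ (Equivalence.to T-─ (partner-edge M′ i′ i′∈L─S)) (subst (T ∘ C) eq (M⊆C i i∈S))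

    injective : ∀ {i i′} i∈L i′∈L i∈S? i′∈S? → choose i i∈L i∈S? ≡ choose i′ i′∈L i′∈S? → i ≡ i′
    injective _   _    (yes i∈S) (yes i′∈S) = partner-injective M i∈S i′∈S
    injective i∈L i′∈L (no  i∉S) (no  i′∉S) = partner-injective M′ (rest i∈L i∉S) (rest i′∈L i′∉S)
    injective _   i′∈L (yes i∈S) (no  i′∉S) = ⊥-elim ∘ M≢M′ i∈S (rest i′∈L i′∉S)
    injective i∈L _    (no  i∉S) (yes i′∈S) = ⊥-elim ∘ M≢M′ i′∈S (rest i∈L i∉S) ∘ sym

-- Either a tight S splits L into S and L ─ S, the latter matched away from the neighbours of S,
-- or every proper subset has a surplus and any single edge a–b can be matched first.
hall : ∀ (E : Fin m → Fin m′ → Bool) L → HallCondition E L → SaturatingMatching E L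
hall E L hallL = go E L hallL (<-wellFounded (count L))
  where
  go : ∀ E L → HallCondition E L → Acc _<_ (count L) → SaturatingMatching E L
  go E L hallL (acc rec) with tight-or-surplus {E = E} L
  ... | inj₁ (S , S⊆L , S≢∅ , S<L , NS≤S) =
    join S⊆L M-S (λ i i∈S → Equivalence.from T-Neighbours (i , i∈S , partner-edge M-S i i∈S))
      (go (E avoiding Neighbours E S) (L ─ S) (hall-avoiding-tight {E = E} hallL S⊆L NS≤S) (rec L─S<L))
    where
    M-S : SaturatingMatching E S
    M-S = go E S (hall-⊆ {E = E} S⊆L hallL) (rec S<L)
    L─S<L : count (L ─ S) < count L
    L─S<L = begin-strict
      count (L ─ S)            <⟨ +-monoˡ-< (count (L ─ S)) S≢∅ ⟩
      count S + count (L ─ S)  ≡⟨ count-⊆-split {p = S} {L} S⊆L ⟨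
      count L                  ∎
      where open ≤-Reasoning
  ... | inj₂ surplus with 0 <? count L
  ...   | no  L≡∅ = empty-matching {E = E} L≡∅
  ...   | yes L≢∅ with a , a∈L , b , eab ← hall⇒edge {E = E} hallL L≢∅ =
    join (⁅⁆⊆ {p = L} a∈L) (edge-matching eab) (λ _ _ → Equivalence.from (T-⁅⁆ {a = b}) refl)
      (go (E avoiding ⁅ b ⁆) (L - a) (hall-avoiding-edge {E = E} surplus a∈L)
          (rec (≤-reflexive (sym (count-remove {p = L} a∈L)))))

-- One-factorisations of regular bipartite graphs

injective⇒surjective : ∀ {f : Fin m → Fin m′} → Injective _≡_ _≡_ f → m′ ≤ m → ∀ j → ∃ λ i → f i ≡ j
injective⇒surjective {m′ = zero}          _     _        ()
injective⇒surjective {m} {suc m′} {f} f-inj 1+m′≤m j with any? (λ i → f i ≟ j)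
... | yes hit  = hit
... | no  miss = contradiction (injective⇒≤ g-inj) (<⇒≱ 1+m′≤m)
  where
  j≢f : ∀ i → j ≢ f i
  j≢f i j≡fi = miss (i , sym j≡fi)
  g : Fin m → Fin m′
  g i = punchOut (j≢f i)
  g-inj : Injective _≡_ _≡_ g
  g-inj {x} {y} = f-inj ∘ punchOut-injective (j≢f x) (j≢f y)

Regular : ℕ → (Fin m → Fin m′ → Bool) → Set
Regular k E = (∀ i → count (E i) ≡ k) × (∀ j → count (flip E j) ≡ k)

𝟙-*-count : ∀ b (p : Fin m → Bool) → 𝟙 b * count p ≡ count (λ i → b ∧ p i)
𝟙-*-count {m} false p = sym (sum-replicate-zero m)
𝟙-*-count     true  p = *-identityˡ (count p)

regular⇒hall : ∀ {E : Fin m → Fin m′ → Bool} → Regular (suc k) E → HallCondition E (λ _ → true)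
regular⇒hall {k = k} {E} (rows , columns) S _ =
  *-cancelʳ-≤ (count S) (count (Neighbours E S)) (suc k) (begin
    count S * suc k                           ≡⟨ *-distribʳ-sum (suc k) (𝟙 ∘ S) ⟩
    sum (λ i → 𝟙 (S i) * suc k)               ≡⟨ sum-cong-≗ edges-at ⟩
    sum (λ i → count (λ j → S i ∧ E i j))     ≡⟨ ∑-comm (λ i j → 𝟙 (S i ∧ E i j)) ⟩
    sum (λ j → count (λ i → S i ∧ E i j))     ≤⟨ sum-mono-≤ column-bound ⟩
    sum (λ j → 𝟙 (Neighbours E S j) * suc k)  ≡⟨ *-distribʳ-sum (suc k) (𝟙 ∘ Neighbours E S) ⟨
    count (Neighbours E S) * suc k            ∎)
  where
  open ≤-Reasoning
  edges-at : ∀ i → 𝟙 (S i) * suc k ≡ count (λ j → S i ∧ E i j)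
  edges-at i = trans (cong (𝟙 (S i) *_) (sym (rows i))) (𝟙-*-count (S i) (E i))
  column-bound : ∀ j → count (λ i → S i ∧ E i j) ≤ 𝟙 (Neighbours E S j) * suc k
  column-bound j with Neighbours E S j in j∈N?
  ... | true  = begin
    count (λ i → S i ∧ E i j)  ≤⟨ count-mono {p = λ i → S i ∧ E i j} {flip E j} (proj₂ ∘ Equivalence.to T-∧) ⟩
    count (flip E j)           ≡⟨ columns j ⟩
    suc k                      ≡⟨ +-identityʳ (suc k) ⟨
    1 * suc k                  ∎
  ... | false = ≮⇒≥ λ 0<count → let i , i∈S∩Eʲ = 0<count⇒∈ _ 0<count in
    subst T j∈N? (Equivalence.from T-Neighbours (i , Equivalence.to T-∧ i∈S∩Eʲ))

-- Hall for the transposed graph gives m′ ≤ m, so the saturating matching is onto.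
regular⇒perfectMatching : ∀ {E : Fin m → Fin m′ → Bool} → Regular (suc k) E →
                          Σ (Fin m ↔ Fin m′) λ π → ∀ i → T (E i (Inverse.to π i))
regular⇒perfectMatching {m} {m′} {E = E} regular =
  mk↔ₛ′ σ σ⁻¹ σ∘σ⁻¹ σ⁻¹∘σ , λ i → partner-edge rows-matched i tt
  where
  rows-matched : SaturatingMatching E (λ _ → true)
  rows-matched = hall E _ (regular⇒hall regular)
  columns-matched : SaturatingMatching (flip E) (λ _ → true)
  columns-matched = hall (flip E) _ (regular⇒hall (swap regular))
  σ : Fin m → Fin m′
  σ i = partner rows-matched i tt
  σ-injective : Injective _≡_ _≡_ σ
  σ-injective = partner-injective rows-matched tt tt
  σ-surjective : ∀ j → ∃ λ i → σ i ≡ j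
  σ-surjective = injective⇒surjective σ-injective (injective⇒≤ (partner-injective columns-matched tt tt))
  σ⁻¹ : Fin m′ → Fin m
  σ⁻¹ = proj₁ ∘ σ-surjective
  σ∘σ⁻¹ : ∀ j → σ (σ⁻¹ j) ≡ j
  σ∘σ⁻¹ = proj₂ ∘ σ-surjective
  σ⁻¹∘σ : ∀ i → σ⁻¹ (σ i) ≡ i
  σ⁻¹∘σ i = σ-injective (σ∘σ⁻¹ (σ i))

record OneFactorisation (k : ℕ) (E : Fin m → Fin m′ → Bool) : Set where
  field
    factor   : Fin k → Fin m ↔ Fin m′
    disjoint : ∀ {t t′ i} → Inverse.to (factor t) i ≡ Inverse.to (factor t′) i → t ≡ t′
    covers   : ∀ {i j} → T (E i j) ⇔ ∃ λ t → Inverse.to (factor t) i ≡ j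

oneFactorisation : ∀ k {E : Fin m → Fin m′ → Bool} → Regular k E → OneFactorisation k E
oneFactorisation zero {E} (rows , _) = record
  { factor   = λ ()
  ; disjoint = λ { {()} }
  ; covers   = λ {i} → mk⇔ (λ e → ⊥-elim (n≮0 (subst (0 <_) (rows i) (∈⇒0<count {p = E i} e)))) (λ ())
  }
oneFactorisation {m} {m′} (suc k) {E} regular@(rows , columns) = record
  { factor   = factor
  ; disjoint = disjoint
  ; covers   = covers
  }
  where
  π : Fin m ↔ Fin m′
  π = proj₁ (regular⇒perfectMatching regular)
  open Inverse π using (to; from; strictlyInverseˡ; strictlyInverseʳ)
  π-edge : ∀ i → T (E i (to i))
  π-edge = proj₂ (regular⇒perfectMatching regular)

  E′ : Fin m → Fin m′ → Bool
  E′ i = E i - to i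

  ≟-to-from : ∀ i j → does (j ≟ to i) ≡ does (i ≟ from j)
  ≟-to-from i j with j ≟ to i | i ≟ from j
  ... | yes _      | yes _      = refl
  ... | no  _      | no  _      = refl
  ... | yes j≡to-i | no  i≢from = ⊥-elim (i≢from (trans (sym (strictlyInverseʳ i)) (cong from (sym j≡to-i))))
  ... | no  j≢to-i | yes i≡from = ⊥-elim (j≢to-i (trans (sym (strictlyInverseˡ j)) (cong to (sym i≡from))))

  regular′ : Regular k E′
  regular′ = (λ i → suc-injective (trans (sym (count-remove {p = E i} (π-edge i))) (rows i))) ,
             (λ j → suc-injective (begin
               suc (count (flip E′ j))          ≡⟨ cong suc (count-cong λ i → cong (λ b → E i j ∧ not b) (≟-to-from i j)) ⟩
               suc (count (flip E j - from j))  ≡⟨ count-remove {p = flip E j} (π-edge-at j) ⟨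
               count (flip E j)                 ≡⟨ columns j ⟩
               suc k                            ∎))
    where
    open ≡-Reasoning
    π-edge-at : ∀ j → T (E (from j) j)
    π-edge-at j = subst (T ∘ E (from j)) (strictlyInverseˡ j) (π-edge (from j))

  module F = OneFactorisation (oneFactorisation k regular′)

  factor : Fin (suc k) → Fin m ↔ Fin m′
  factor zero    = π
  factor (suc t) = F.factor t

  F-avoids-π : ∀ t {i j} → Inverse.to (F.factor t) i ≡ j → ¬ T (⁅ to i ⁆ j)
  F-avoids-π t eq = proj₂ (Equivalence.to T-─ (Equivalence.from F.covers (t , eq)))

  disjoint : ∀ {t t′ i} → Inverse.to (factor t) i ≡ Inverse.to (factor t′) i → t ≡ t′
  disjoint {zero}  {zero}   _  = refl
  disjoint {zero}  {suc t′} eq = ⊥-elim (F-avoids-π t′ refl (Equivalence.from T-⁅⁆ (sym eq)))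
  disjoint {suc t} {zero}   eq = ⊥-elim (F-avoids-π t refl (Equivalence.from T-⁅⁆ eq))
  disjoint {suc t} {suc t′} eq = cong suc (F.disjoint eq)

  covers : ∀ {i j} → T (E i j) ⇔ ∃ λ t → Inverse.to (factor t) i ≡ j
  covers {i} {j} = mk⇔ to-factor from-factor
    where
    to-factor : T (E i j) → ∃ λ t → Inverse.to (factor t) i ≡ j
    to-factor e with j ≟ to i
    ... | yes j≡to-i = zero , sym j≡to-i
    ... | no  j≢to-i with t , eq ← Equivalence.to F.covers (Equivalence.from T-─ (e , j≢to-i ∘ Equivalence.to T-⁅⁆))
      = suc t , eq
    from-factor : (∃ λ t → Inverse.to (factor t) i ≡ j) → T (E i j)
    from-factor (zero  , eq) = subst (T ∘ E i) eq (π-edge i)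
    from-factor (suc t , eq) = proj₁ (Equivalence.to T-─ (Equivalence.from F.covers (t , eq)))

-- Stable matchings from disjoint perfect matchings

lookup-tabulate′ : ∀ {A : Set} (f : Fin m → A) i → lookup (tabulate f) i ≡ f (cast (length-tabulate f) i)
lookup-tabulate′ {suc m} f zero    = refl
lookup-tabulate′ {suc m} f (suc i) = lookup-tabulate′ (f ∘ suc) i

Prefers-tabulate : ∀ {f : Fin k → Fin m} → Injective _≡_ _≡_ f →
                   ∀ {u v} → Prefers (tabulate f) (f u) (f v) → u <ᶠ v
Prefers-tabulate {f = f} f-injective (i , j , i↦u , j↦v , i<j) =
  subst₂ _<_ (rank i i↦u) (rank j j↦v) i<j
  where
  rank : ∀ {w} i → lookup (tabulate f) i ≡ f w → toℕ i ≡ toℕ w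
  rank i i↦w = trans (sym (toℕ-cast _ i)) (cong toℕ (f-injective (trans (sym (lookup-tabulate′ f i)) i↦w)))

opposite-reflects-< : ∀ {u v : Fin k} → opposite u <ᶠ opposite v → v <ᶠ u
opposite-reflects-< {k} {u} {v} ou<ov = ≰⇒> λ u≤v → <⇒≱ ou<ov (begin
  toℕ (opposite v)  ≡⟨ opposite-prop v ⟩
  k ∸ suc (toℕ v)   ≤⟨ ∸-monoʳ-≤ k (s≤s u≤v) ⟩
  k ∸ suc (toℕ u)   ≡⟨ opposite-prop u ⟨
  toℕ (opposite u)  ∎)
  where open ≤-Reasoning

opposite-injective : ∀ {u v : Fin k} → opposite u ≡ opposite v → u ≡ v
opposite-injective {u = u} {v} eq =
  trans (sym (opposite-involutive u)) (trans (cong opposite eq) (opposite-involutive v))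

module FactorInstance {k m m′ : ℕ} (σ : Fin k → Fin m ↔ Fin m′)
  (disjoint : ∀ {t t′ i} → Inverse.to (σ t) i ≡ Inverse.to (σ t′) i → t ≡ t′) where

  private
    to : Fin k → Fin m → Fin m′
    to t = Inverse.to (σ t)
    from : Fin k → Fin m′ → Fin m
    from t = Inverse.from (σ t)

    to-from : ∀ t r → to t (from t r) ≡ r
    to-from t = Inverse.strictlyInverseˡ (σ t)
    from-to : ∀ t s → from t (to t s) ≡ s
    from-to t = Inverse.strictlyInverseʳ (σ t)

    to-injective : ∀ t {s s′} → to t s ≡ to t s′ → s ≡ s′
    to-injective t {s} {s′} eq = trans (sym (from-to t s)) (trans (cong (from t) eq) (from-to t s′))

    studentRanking : Fin m → Fin k → Fin m′
    studentRanking s t = to t s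
    residencyRanking : Fin m′ → Fin k → Fin m
    residencyRanking r t = from (opposite t) r

    residencyRanking-injective : ∀ r → Injective _≡_ _≡_ (residencyRanking r)
    residencyRanking-injective r {u} {v} eq = opposite-injective (disjoint (begin
      to (opposite u) (from (opposite u) r)  ≡⟨ to-from (opposite u) r ⟩
      r                                      ≡⟨ to-from (opposite v) r ⟨
      to (opposite v) (from (opposite v) r)  ≡⟨ cong (to (opposite v)) eq ⟨
      to (opposite v) (from (opposite u) r)  ∎))
      where open ≡-Reasoning

    ranked : ∀ {t s r} → to t s ≡ r → residencyRanking r (opposite t) ≡ s
    ranked {t} {s} {r} s↦r =
      trans (cong (λ u → from u r) (opposite-involutive t)) (trans (cong (from t) (sym s↦r)) (from-to t s))

    matched : ∀ {t s r} → does (to t s ≟ r) ≡ true ⇔ to t s ≡ r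
    matched {t} {s} {r} with to t s ≟ r
    ... | yes s↦r = mk⇔ (λ _ → s↦r) (λ _ → refl)
    ... | no  s↛r = mk⇔ (λ ()) (⊥-elim ∘ s↛r)

  factorInstance : Instance
  factorInstance = record
    { nS          = m
    ; nR          = m′
    ; sPref       = tabulate ∘ studentRanking
    ; rPref       = tabulate ∘ residencyRanking
    ; sPrefUnique = λ s → tabulate⁺ disjoint
    ; rPrefUnique = λ r → tabulate⁺ (residencyRanking-injective r)
    }

  factorMatching : Fin k → Matching factorInstance
  factorMatching t = record
    { M     = λ s r → does (to t s ≟ r)
    ; sUniq = λ s r r′ s↦r s↦r′ → trans (sym (Equivalence.to matched s↦r)) (Equivalence.to matched s↦r′)
    ; rUniq = λ s s′ r s↦r s′↦r →
                to-injective t (trans (Equivalence.to matched s↦r) (sym (Equivalence.to matched s′↦r)))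
    }

  acceptable⇔ : ∀ {s r} → MutuallyAcceptable factorInstance s r ⇔ ∃ λ t → to t s ≡ r
  acceptable⇔ {s} {r} = mk⇔ (listed ∘ proj₁) λ (t , s↦r) →
    subst (_∈ _) s↦r (∈-tabulate⁺ t) , subst (_∈ _) (ranked s↦r) (∈-tabulate⁺ (opposite t))
    where
    listed : r ∈ tabulate (studentRanking s) → ∃ λ t → to t s ≡ r
    listed r∈ with t , r≡ ← ∈-tabulate⁻ r∈ = t , sym r≡

  factorMatching-stable : ∀ t → Stable factorInstance (factorMatching t)
  factorMatching-stable t =
    (λ s r s↦r → Equivalence.from acceptable⇔ (t , Equivalence.to matched s↦r)) ,
    λ { s r (acceptable , _ , student , residency) →
          let _ , s↦r = Equivalence.to acceptable⇔ acceptable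
          in <-asym (student-prefers student s↦r) (residency-prefers residency s↦r) }
    where
    student-prefers : ∀ {s r t′} → StudentWantsToSwitch factorInstance (factorMatching t) s r →
                      to t′ s ≡ r → t′ <ᶠ t
    student-prefers {s} (inj₁ unmatched) _ = ⊥-elim (unmatched (to t s) (Equivalence.from matched refl))
    student-prefers {s} (inj₂ (r′ , s↦r′ , prefers)) s↦r =
      Prefers-tabulate disjoint
        (subst₂ (Prefers (tabulate (studentRanking s))) (sym s↦r) (sym (Equivalence.to matched s↦r′)) prefers)

    residency-prefers : ∀ {s r t′} → ResidencyWantsToSwitch factorInstance (factorMatching t) s r →
                        to t′ s ≡ r → t <ᶠ t′
    residency-prefers {r = r} (inj₁ unmatched) _ =
      ⊥-elim (unmatched (from t r) (Equivalence.from matched (to-from t r)))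
    residency-prefers {r = r} (inj₂ (s′ , s′↦r , prefers)) s↦r =
      opposite-reflects-< (Prefers-tabulate (residencyRanking-injective r)
        (subst₂ (Prefers (tabulate (residencyRanking r))) (sym (ranked s↦r))
                (sym (ranked (Equivalence.to matched s′↦r))) prefers))

  stablyMatchable⇔ : ∀ {s r} → StablyMatchable factorInstance s r ⇔ ∃ λ t → to t s ≡ r
  stablyMatchable⇔ {s} {r} = mk⇔
    (λ (_ , (acceptable , _) , s↦r) → Equivalence.to acceptable⇔ (acceptable s r s↦r))
    (λ (t , s↦r) → factorMatching t , factorMatching-stable t , Equivalence.from matched s↦r)

-- Bipartite graphs

length-filterᵇ-tabulate : ∀ {A : Set} (p : A → Bool) (f : Fin m → A) →
                          length (filterᵇ p (tabulate f)) ≡ count (p ∘ f)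
length-filterᵇ-tabulate {zero}  p f = refl
length-filterᵇ-tabulate {suc m} p f with p (f zero)
... | true  = cong suc (length-filterᵇ-tabulate p (f ∘ suc))
... | false = length-filterᵇ-tabulate p (f ∘ suc)

record ColourClasses (c : Fin m → Bool) : Set where
  field
    #true #false : ℕ
    vertex       : Fin #true ⊎ Fin #false → Fin m
    index        : Fin m → Fin #true ⊎ Fin #false
    vertex-index : ∀ u → vertex (index u) ≡ u
    index-vertex : ∀ x → index (vertex x) ≡ x
    colour-true  : ∀ s → c (vertex (inj₁ s)) ≡ true
    colour-false : ∀ r → c (vertex (inj₂ r)) ≡ false
    count-split  : ∀ p → count p ≡ count (p ∘ vertex ∘ inj₁) + count (p ∘ vertex ∘ inj₂)

colourClasses : (c : Fin m → Bool) → ColourClasses c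
colourClasses {zero} c = record
  { #true        = 0
  ; #false       = 0
  ; vertex       = λ { (inj₁ ()) ; (inj₂ ()) }
  ; index        = λ ()
  ; vertex-index = λ ()
  ; index-vertex = λ { (inj₁ ()) ; (inj₂ ()) }
  ; colour-true  = λ ()
  ; colour-false = λ ()
  ; count-split  = λ _ → refl
  }
colourClasses {suc m} c with c zero in c₀ | colourClasses (c ∘ suc)
... | true | C = record
  { #true        = suc #true
  ; #false       = #false
  ; vertex       = vertex′
  ; index        = index′
  ; vertex-index = vertex-index′
  ; index-vertex = index-vertex′
  ; colour-true  = λ { zero → c₀ ; (suc s) → colour-true s }
  ; colour-false = colour-false
  ; count-split  = λ p → trans (cong (𝟙 (p zero) +_) (count-split (p ∘ suc))) (sym (+-assoc (𝟙 (p zero)) _ _))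
  }
  where
  open ColourClasses C
  vertex′ : Fin (suc #true) ⊎ Fin #false → Fin (suc m)
  vertex′ (inj₁ zero)    = zero
  vertex′ (inj₁ (suc s)) = suc (vertex (inj₁ s))
  vertex′ (inj₂ r)       = suc (vertex (inj₂ r))
  index′ : Fin (suc m) → Fin (suc #true) ⊎ Fin #false
  index′ zero    = inj₁ zero
  index′ (suc u) = map₁ suc (index u)
  vertex′-map₁ : ∀ x → vertex′ (map₁ suc x) ≡ suc (vertex x)
  vertex′-map₁ (inj₁ s) = refl
  vertex′-map₁ (inj₂ r) = refl
  vertex-index′ : ∀ u → vertex′ (index′ u) ≡ u
  vertex-index′ zero    = refl
  vertex-index′ (suc u) = trans (vertex′-map₁ (index u)) (cong suc (vertex-index u))
  index-vertex′ : ∀ x → index′ (vertex′ x) ≡ x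
  index-vertex′ (inj₁ zero)    = refl
  index-vertex′ (inj₁ (suc s)) = cong (map₁ suc) (index-vertex (inj₁ s))
  index-vertex′ (inj₂ r)       = cong (map₁ suc) (index-vertex (inj₂ r))
... | false | C = record
  { #true        = #true
  ; #false       = suc #false
  ; vertex       = vertex′
  ; index        = index′
  ; vertex-index = vertex-index′
  ; index-vertex = index-vertex′
  ; colour-true  = colour-true
  ; colour-false = λ { zero → c₀ ; (suc r) → colour-false r }
  ; count-split  = λ p → trans (cong (𝟙 (p zero) +_) (count-split (p ∘ suc)))
                                (x∙yz≈y∙xz (𝟙 (p zero)) (count (p ∘ suc ∘ vertex ∘ inj₁)) _)
  }
  where
  open ColourClasses C
  vertex′ : Fin #true ⊎ Fin (suc #false) → Fin (suc m)
  vertex′ (inj₁ s)       = suc (vertex (inj₁ s))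
  vertex′ (inj₂ zero)    = zero
  vertex′ (inj₂ (suc r)) = suc (vertex (inj₂ r))
  index′ : Fin (suc m) → Fin #true ⊎ Fin (suc #false)
  index′ zero    = inj₂ zero
  index′ (suc u) = map₂ suc (index u)
  vertex′-map₂ : ∀ x → vertex′ (map₂ suc x) ≡ suc (vertex x)
  vertex′-map₂ (inj₁ s) = refl
  vertex′-map₂ (inj₂ r) = refl
  vertex-index′ : ∀ u → vertex′ (index′ u) ≡ u
  vertex-index′ zero    = refl
  vertex-index′ (suc u) = trans (vertex′-map₂ (index u)) (cong suc (vertex-index u))
  index-vertex′ : ∀ x → index′ (vertex′ x) ≡ x
  index-vertex′ (inj₁ s)       = cong (map₂ suc) (index-vertex (inj₁ s))
  index-vertex′ (inj₂ zero)    = refl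
  index-vertex′ (inj₂ (suc r)) = cong (map₂ suc) (index-vertex (inj₂ r))

module BipartiteGraph (G : Graph) (c : Fin (Graph.n G) → Bool)
                      (bipartite : ∀ u v → adj G u v ≡ true → c u ≢ c v) where

  open ColourClasses (colourClasses c) public

  same-colour⇒nonadjacent : ∀ {u v} → c u ≡ c v → ¬ T (adj G u v)
  same-colour⇒nonadjacent {u} {v} cu≡cv uv = bipartite u v (Equivalence.to T-≡ uv) cu≡cv

  nonadjacent₁ : ∀ s s′ → ¬ T (adj G (vertex (inj₁ s)) (vertex (inj₁ s′)))
  nonadjacent₁ s s′ = same-colour⇒nonadjacent (trans (colour-true s) (sym (colour-true s′)))

  nonadjacent₂ : ∀ r r′ → ¬ T (adj G (vertex (inj₂ r)) (vertex (inj₂ r′)))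
  nonadjacent₂ r r′ = same-colour⇒nonadjacent (trans (colour-false r) (sym (colour-false r′)))

  adj-comm : ∀ u v → adj G u v ≡ adj G v u
  adj-comm u v with adj G u v in uv | adj G v u in vu
  ... | true  | true  = refl
  ... | false | false = refl
  ... | true  | false = trans (sym (Graph.sym G u v uv)) vu
  ... | false | true  = sym (trans (sym (Graph.sym G v u vu)) uv)

  biadjacency : Fin #true → Fin #false → Bool
  biadjacency s r = adj G (vertex (inj₁ s)) (vertex (inj₂ r))

  biadjacency-regular : ∀ {k} → (∀ u → degree G u ≡ k) → Regular k biadjacency
  biadjacency-regular {k} regular = rows , columns
    where
    open ≡-Reasoning
    degree-split : ∀ u → count (adj G u ∘ vertex ∘ inj₁) + count (adj G u ∘ vertex ∘ inj₂) ≡ k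
    degree-split u =
      trans (sym (count-split (adj G u))) (trans (sym (length-filterᵇ-tabulate (adj G u) id)) (regular u))

    rows : ∀ s → count (biadjacency s) ≡ k
    rows s = begin
      count (biadjacency s)                                    ≡⟨ cong (_+ count (biadjacency s)) (∉⇒count≡0 (nonadjacent₁ s)) ⟨
      count (adj G u ∘ vertex ∘ inj₁) + count (biadjacency s)  ≡⟨ degree-split u ⟩
      k                                                        ∎
      where u = vertex (inj₁ s)

    columns : ∀ r → count (flip biadjacency r) ≡ k
    columns r = begin
      count (flip biadjacency r)          ≡⟨ count-cong (λ s → adj-comm (vertex (inj₁ s)) u) ⟩
      count (adj G u ∘ vertex ∘ inj₁)      ≡⟨ +-identityʳ _ ⟨
      count (adj G u ∘ vertex ∘ inj₁) + 0  ≡⟨ cong (count (adj G u ∘ vertex ∘ inj₁) +_) (∉⇒count≡0 (nonadjacent₂ r)) ⟨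
      count (adj G u ∘ vertex ∘ inj₁) + count (adj G u ∘ vertex ∘ inj₂)  ≡⟨ degree-split u ⟩
      k                                    ∎
      where u = vertex (inj₂ r)

mainTheorem4 : (G : Graph) → IsBipartite G → IsRegular G →
    Σ Instance λ I → IsoToSMGraph G I
mainTheorem4 G (c , bipartite) (k , regular) =
  factorInstance , mk↔ₛ′ index vertex index-vertex vertex-index , adjacency
  where
  open BipartiteGraph G c bipartite
  open OneFactorisation (oneFactorisation k (biadjacency-regular regular))
  open FactorInstance factor disjoint

  edge⇔ : ∀ {s r} → adj G (vertex (inj₁ s)) (vertex (inj₂ r)) ≡ true ⇔ StablyMatchable factorInstance s r
  edge⇔ = ⇔-sym stablyMatchable⇔ ⇔-∘ (covers ⇔-∘ ⇔-sym T-≡)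

  vertex-adjacency : ∀ x y → adj G (vertex x) (vertex y) ≡ true ⇔ SMAdj factorInstance x y
  vertex-adjacency (inj₁ s) (inj₂ r)  = edge⇔
  vertex-adjacency (inj₂ r) (inj₁ s)  = edge⇔ ⇔-∘ mk⇔ (Graph.sym G _ _) (Graph.sym G _ _)
  vertex-adjacency (inj₁ s) (inj₁ s′) = mk⇔ (nonadjacent₁ s s′ ∘ Equivalence.from T-≡) λ ()
  vertex-adjacency (inj₂ r) (inj₂ r′) = mk⇔ (nonadjacent₂ r r′ ∘ Equivalence.from T-≡) λ ()

  adjacency : ∀ u v → adj G u v ≡ true ⇔ SMAdj factorInstance (index u) (index v)
  adjacency u v = subst₂ (λ u′ v′ → adj G u′ v′ ≡ true ⇔ SMAdj factorInstance (index u) (index v))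
                         (vertex-index u) (vertex-index v) (vertex-adjacency (index u) (index v))
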